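{- Let $k\ge 1$ be an integer and let $M$ be an even integer. Consider the New Amsterdam digraph $N\!A(M;\alpha,\beta,\gamma,\delta)$ with steps $$\beta=-\alpha=1,\qquad \gamma=-\delta=2k+1,$$ i.e. the digraph with vertex set $\mathbb{Z}_M$ in which every even vertex $i$ has arcs to $i-1$ and $i+1$, and every odd vertex $j$ has arcs to $j+2k+1$ and $j-2k-1$ (arithmetic modulo $M$). Let $D$ denote its diameter. Then: (a) if $4k^2+4\le M\le 4k^2+4k+2$, then $D=2k+1$; (b) if $M=4k^2+4k+4$, then $D=2k+2$; (c) if $4k^2+4k+8\le M\le 4(k+1)^2+2$, then $D=2k+3$.
   Context: A New Amsterdam digraph $N\!A(M;\alpha,\beta,\gamma,\delta)$, for even $M$ and odd integers $\alpha\neq\beta,\gamma,\delta$ with $\alpha+\beta+\gamma+\delta\equiv 0 \pmod M$, is the bipartite digraph on $\mathbb{Z}_M$ where each even vertex $i$ has arcs to $i+\alpha,i+\beta$ and each odd vertex $j$ has arcs to $j+\gamma,j+\delta$ (mod $M$). The diameter of a digraph is the maximum, over ordered pairs of vertices $(u,v)$, of the length of a shortest directed path from $u$ to $v$. -}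

module Defs where

open import Data.Nat using (ℕ; zero; suc; _<_; _≤_)
open import Data.Nat.Divisibility using () renaming (_∣_ to _∣ℕ_)
open import Data.Integer using (ℤ; +_; _-_; -_)
open import Data.Integer.Divisibility using (_∣_)
open import Data.Product using (Σ; _×_; ∃; ∃₂)
open import Relation.Nullary using (¬_)

-- Vertices of Z_M are represented by naturals u with u < M.
-- "v ≡ u + s (mod M)" is expressed as  (+ M) ∣ (+ v - (+ u + s))  in ℤ.
_≡_+_[mod_] : ℕ → ℕ → ℤ → ℕ → Set
v ≡ u + s [mod M ] = (+ M) ∣ ((+ v) - ((+ u) Data.Integer.+ s))

data NAArc (M : ℕ) (α β γ δ : ℤ) (u v : ℕ) : Set where
  arcα : 2 ∣ℕ u → v ≡ u + α [mod M ] → NAArc M α β γ δ u v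
  arcβ : 2 ∣ℕ u → v ≡ u + β [mod M ] → NAArc M α β γ δ u v
  arcγ : ¬ (2 ∣ℕ u) → v ≡ u + γ [mod M ] → NAArc M α β γ δ u v
  arcδ : ¬ (2 ∣ℕ u) → v ≡ u + δ [mod M ] → NAArc M α β γ δ u v

data NAWalk (M : ℕ) (α β γ δ : ℤ) : ℕ → ℕ → ℕ → Set where
  here : ∀ {u} → u < M → NAWalk M α β γ δ zero u u
  step : ∀ {n u v w} → u < M → NAArc M α β γ δ u v →
         NAWalk M α β γ δ n v w → NAWalk M α β γ δ (suc n) u w

-- The diameter of NA(M; α, β, γ, δ) equals D: every ordered pair is joined by a
-- walk of length ≤ D, and some ordered pair has no walk of length < D
-- (i.e. max over pairs of the shortest-path distance is exactly D).
NADiameter : ℕ → ℤ → ℤ → ℤ → ℤ → ℕ → Set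
NADiameter M α β γ δ D =
  (∀ u v → u < M → v < M → ∃ λ n → n ≤ D × NAWalk M α β γ δ n u v)
  × ∃₂ λ u v → u < M × v < M × (∀ n → n < D → ¬ NAWalk M α β γ δ n u v)

-- Every walk alternates ±1 steps (from even vertices) with ±(2k+1) steps (from odd ones), so a walk of
-- 2m or 2m+1 steps from 0 ends within m(2k+2) or m(2k+2)+1 of 0 modulo M; a vertex farther away than that
-- bounds the diameter from below.  Conversely, two consecutive steps move by ±1 ± (2k+1), so |x| + |y| such
-- pairs realise the displacement 2R(x, y) with R(x, y) = x(k+1) + yk, and reaching v from u amounts to
-- solving R(x, y) ≡ (v − u)/2 (mod M/2), after one preliminary step when v − u is odd.  Every 0 ≤ e ≤ k² + k
-- is some R(x, y) with |x| + |y| ≤ k, and every e ≤ (k+1)² one with |x| + |y| ≤ k + 1; with negation this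
-- covers every residue modulo M/2 in the three ranges of M, except the residue k² + k + 1 when
-- M = 4k² + 4k + 4, which the free sign of the preliminary step avoids.
module Submission where

open import Defs
open import Data.Nat using (ℕ; zero; suc; _+_; _*_; _≤_; _<_; z≤n; s≤s; NonZero)
open import Relation.Binary.PropositionalEquality
open import Data.Nat.Divisibility
  using (_∣_; _∣?_; divides; ∣m∣n⇒∣m+n; ∣m+n∣m⇒∣n; ∣-refl; _∣0; ∣⇒≤; >⇒∤)
import Data.Nat.Properties as ℕ
import Data.Nat.DivMod as DivMod
open import Data.Integer as ℤ using (ℤ; +_; -[1+_]; -_; _-_; ∣_∣; 0ℤ)
import Data.Integer.Properties as ℤ
open import Data.Integer.Divisibility.Signed as Signed
  using (divides; ∣ᵤ⇒∣; ∣⇒∣ᵤ) renaming (_∣_ to _∣ℤ_)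
open import Data.Integer.DivMod using (_%ℕ_; _/ℕ_; n%ℕd<d; a≡a%ℕn+[a/ℕn]*n)
open import Data.Integer.Tactic.RingSolver using (solve-∀)
import Data.Nat.Tactic.RingSolver as NatSolver
open import Data.Product using (_×_; _,_; ∃; ∃₂; proj₂)
open import Data.Sum using (_⊎_; inj₁; inj₂)
open import Relation.Nullary using (¬_; yes; no; contradiction)

Even Odd : ℕ → Set
Even n = 2 ∣ n
Odd n = ¬ Even n

even⊎even-suc : ∀ n → Even n ⊎ Even (suc n)
even⊎even-suc zero = inj₁ (2 ∣0)
even⊎even-suc (suc n) with even⊎even-suc n
... | inj₁ 2∣n = inj₂ (∣m∣n⇒∣m+n ∣-refl 2∣n)
... | inj₂ 2∣1+n = inj₁ 2∣1+n

odd⇒even-suc : ∀ {n} → Odd n → Even (suc n)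
odd⇒even-suc {n} n-odd with even⊎even-suc n
... | inj₁ n-even = contradiction n-even n-odd
... | inj₂ 1+n-even = 1+n-even

odd-2k+1 : ∀ k → Odd (2 * k + 1)
odd-2k+1 k 2∣2k+1 = >⇒∤ {n = 1} (s≤s (s≤s z≤n)) (∣m+n∣m⇒∣n 2∣2k+1 (divides k (ℕ.*-comm 2 k)))

≤-by : ∀ {m n} d → m + d ≡ n → m ≤ n
≤-by {m} d refl = ℕ.m≤m+n m d

small-not-divisible : ∀ {N s} → 0 < s → s < N → ¬ + N ∣ℤ + s
small-not-divisible {s = suc s} _ s<N N∣s = >⇒∤ s<N (∣⇒∣ᵤ N∣s)

even-ℤ : ∀ {n} → Even n → + 2 ∣ℤ + n
even-ℤ {n} = ∣ᵤ⇒∣ {+ 2} {+ n}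

odd-ℤ : ∀ {n} → Odd n → + 2 ∣ℤ (+ 1 ℤ.+ + n)
odd-ℤ n-odd = even-ℤ (odd⇒even-suc n-odd)

same-parity⇒2∣difference : ∀ {u v} → (Even u × Even v) ⊎ (Odd u × Odd v) → + 2 ∣ℤ (+ v - + u)
same-parity⇒2∣difference (inj₁ (u-even , v-even)) =
  Signed.∣m∣n⇒∣m-n (even-ℤ v-even) (even-ℤ u-even)
same-parity⇒2∣difference {u} {v} (inj₂ (u-odd , v-odd)) =
  subst (+ 2 ∣ℤ_) (lemma (+ u) (+ v)) (Signed.∣m∣n⇒∣m-n (odd-ℤ v-odd) (odd-ℤ u-odd))
  where
  lemma : ∀ U V → (+ 1 ℤ.+ V) - (+ 1 ℤ.+ U) ≡ V - U
  lemma = solve-∀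

opposite-parity⇒2∣difference : ∀ {u v S} → Odd S → (Even u × Odd v) ⊎ (Odd u × Even v) →
                               + 2 ∣ℤ ((+ v - + u) - + S)
opposite-parity⇒2∣difference {u} {v} {S} S-odd (inj₁ (u-even , v-odd)) =
  subst (+ 2 ∣ℤ_) (lemma (+ u) (+ v) (+ S))
    (Signed.∣m∣n⇒∣m-n (Signed.∣m∣n⇒∣m-n (odd-ℤ v-odd) (even-ℤ u-even)) (odd-ℤ S-odd))
  where
  lemma : ∀ U V S → ((+ 1 ℤ.+ V) - U) - (+ 1 ℤ.+ S) ≡ (V - U) - S
  lemma = solve-∀
opposite-parity⇒2∣difference {u} {v} {S} S-odd (inj₂ (u-odd , v-even)) =
  subst (+ 2 ∣ℤ_) (lemma (+ u) (+ v) (+ S))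
    (Signed.∣m∣n⇒∣m+n
      (Signed.∣m∣n⇒∣m-n (Signed.∣m∣n⇒∣m-n (even-ℤ v-even) (odd-ℤ u-odd)) (odd-ℤ S-odd))
      (Signed.∣-refl {+ 2}))
  where
  lemma : ∀ U V S → ((V - (+ 1 ℤ.+ U)) - (+ 1 ℤ.+ S)) ℤ.+ + 2 ≡ (V - U) - S
  lemma = solve-∀

halve-difference : ∀ {i s} → + 2 ∣ℤ (i - s) → ∃ λ h → i ≡ s ℤ.+ h ℤ.* + 2
halve-difference {i} {s} (divides h eq) = h , trans (lemma i s) (cong (λ d → s ℤ.+ d) eq)
  where
  lemma : ∀ I S → I ≡ S ℤ.+ (I - S)
  lemma = solve-∀

infix 4 _∈±_

data _∈±_ : ℤ → ℕ → Set where
  plus  : ∀ {a} → + a ∈± a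
  minus : ∀ {a} → - + a ∈± a

∈±-neg : ∀ {s a} → s ∈± a → - s ∈± a
∈±-neg plus = minus
∈±-neg {a = a} minus = subst (_∈± a) (sym (ℤ.neg-involutive (+ a))) plus

∈±-abs : ∀ {s a} → s ∈± a → ∣ s ∣ ≡ a
∈±-abs plus = refl
∈±-abs {a = a} minus = ℤ.∣-i∣≡∣i∣ (+ a)

∈±-odd : ∀ {s b} → Odd b → s ∈± b → Odd ∣ s ∣
∈±-odd b-odd s∈±b = subst Odd (sym (∈±-abs s∈±b)) b-odd

-- Congruences modulo M

-- The congruence _≡_+_[mod_] as a record, so that Agda can infer its indices.
record _≡_+_⟨mod_⟩ (v u : ℕ) (s : ℤ) (M : ℕ) : Set where
  constructor mod
  field divides-difference : + M ∣ℤ (+ v - (+ u ℤ.+ s))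

Within : ℕ → ℕ → ℕ → ℕ → Set
Within M B u v = ∃ λ z → ∣ z ∣ ≤ B × v ≡ u + z ⟨mod M ⟩

module _ {M : ℕ} where

  ⟨mod⟩⇒[mod] : ∀ {u v s} → v ≡ u + s ⟨mod M ⟩ → v ≡ u + s [mod M ]
  ⟨mod⟩⇒[mod] (mod d) = ∣⇒∣ᵤ d

  [mod]⇒⟨mod⟩ : ∀ u v {s} → v ≡ u + s [mod M ] → v ≡ u + s ⟨mod M ⟩
  [mod]⇒⟨mod⟩ u v d = mod (∣ᵤ⇒∣ d)

  ≡+-difference : ∀ u v → v ≡ u + (+ v - + u) ⟨mod M ⟩
  ≡+-difference u v = mod (divides 0ℤ (lemma (+ u) (+ v)))
    where
    lemma : ∀ U V → V - (U ℤ.+ (V - U)) ≡ 0ℤ ℤ.* + M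
    lemma = solve-∀

  ≡+-exact : ∀ {u v s} → + v - + u ≡ s → v ≡ u + s ⟨mod M ⟩
  ≡+-exact {u} {v} refl = ≡+-difference u v

  ≡+-refl : ∀ u → u ≡ u + 0ℤ ⟨mod M ⟩
  ≡+-refl u = ≡+-exact (ℤ.+-inverseʳ (+ u))

  ≡+-trans : ∀ {u w v s t} → w ≡ u + s ⟨mod M ⟩ → v ≡ w + t ⟨mod M ⟩ →
             v ≡ u + (s ℤ.+ t) ⟨mod M ⟩
  ≡+-trans {u} {w} {v} {s} {t} (mod w-u-s) (mod v-w-t) =
    mod (subst (+ M ∣ℤ_) (lemma (+ u) (+ w) (+ v) s t) (Signed.∣m∣n⇒∣m+n v-w-t w-u-s))
    where
    lemma : ∀ U W V S T → (V - (W ℤ.+ T)) ℤ.+ (W - (U ℤ.+ S)) ≡ V - (U ℤ.+ (S ℤ.+ T))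
    lemma = solve-∀

  ≡+-cancel : ∀ {u w v s t} → w ≡ u + s ⟨mod M ⟩ → v ≡ u + (s ℤ.+ t) ⟨mod M ⟩ →
              v ≡ w + t ⟨mod M ⟩
  ≡+-cancel {u} {w} {v} {s} {t} (mod w-u-s) (mod v-u-s-t) =
    mod (subst (+ M ∣ℤ_) (lemma (+ u) (+ w) (+ v) s t) (Signed.∣m∣n⇒∣m-n v-u-s-t w-u-s))
    where
    lemma : ∀ U W V S T → (V - (U ℤ.+ (S ℤ.+ T))) - (W - (U ℤ.+ S)) ≡ V - (W ℤ.+ T)
    lemma = solve-∀

  ≡+-shift : ∀ {u v s t} → + M ∣ℤ (t - s) → v ≡ u + t ⟨mod M ⟩ → v ≡ u + s ⟨mod M ⟩
  ≡+-shift {u} {v} {s} {t} M∣t-s (mod v-u-t) =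
    mod (subst (+ M ∣ℤ_) (lemma (+ u) (+ v) s t) (Signed.∣m∣n⇒∣m+n v-u-t M∣t-s))
    where
    lemma : ∀ U V S T → (V - (U ℤ.+ T)) ℤ.+ (T - S) ≡ V - (U ℤ.+ S)
    lemma = solve-∀

  residue : ∀ u s .{{_ : NonZero M}} → ∃ λ w → w < M × w ≡ u + s ⟨mod M ⟩
  residue u s = i %ℕ M , n%ℕd<d i M , mod (divides (- (i /ℕ M))
    (trans (cong (λ j → + (i %ℕ M) - j) (a≡a%ℕn+[a/ℕn]*n i M)) (lemma (+ (i %ℕ M)) (i /ℕ M) (+ M))))
    where
    i : ℤ
    i = + u ℤ.+ s
    lemma : ∀ R Q M′ → R - (R ℤ.+ Q ℤ.* M′) ≡ (- Q) ℤ.* M′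
    lemma = solve-∀

  multiple-<⇒≡0 : ∀ {i} → + M ∣ℤ i → ∣ i ∣ < M → i ≡ 0ℤ
  multiple-<⇒≡0 {i} M∣i ∣i∣<M with ∣ i ∣ in eq
  ... | zero = ℤ.∣i∣≡0⇒i≡0 eq
  ... | suc _ = contradiction (∣⇒≤ (subst (M ∣_) eq (∣⇒∣ᵤ M∣i))) (ℕ.<⇒≱ ∣i∣<M)

  residue-unique : ∀ {u v} → u < M → v < M → v ≡ u + 0ℤ ⟨mod M ⟩ → v ≡ u
  residue-unique {u} {v} u<M v<M (mod M∣v-u-0) =
    ℤ.+-injective (ℤ.i-j≡0⇒i≡j (+ v) (+ u) (multiple-<⇒≡0 M∣v-u ∣v-u∣<M))
    where
    M∣v-u : + M ∣ℤ (+ v - + u)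
    M∣v-u = subst (λ j → + M ∣ℤ (+ v - j)) (ℤ.+-identityʳ (+ u)) M∣v-u-0
    ∣v-u∣<M : ∣ + v - + u ∣ < M
    ∣v-u∣<M = subst (_< M) (cong ∣_∣ (sym (ℤ.m-n≡m⊖n v u)))
                (ℕ.≤-<-trans (ℤ.∣m⊝n∣≤m⊔n v u) (ℕ.⊔-lub v<M u<M))

  ≡+-odd⇒parities-differ : ∀ {u v s} → Even M → Odd ∣ s ∣ → v ≡ u + s ⟨mod M ⟩ →
                           ¬ ((Even u × Even v) ⊎ (Odd u × Odd v))
  ≡+-odd⇒parities-differ {u} {v} {s} M-even s-odd (mod M∣v-u-s) same-parity =
    s-odd (∣⇒∣ᵤ (subst (+ 2 ∣ℤ_) (lemma (+ u) (+ v) s)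
      (Signed.∣m∣n⇒∣m-n (same-parity⇒2∣difference same-parity)
                        (Signed.∣-trans (even-ℤ M-even) M∣v-u-s))))
    where
    lemma : ∀ U V S → (V - U) - (V - (U ℤ.+ S)) ≡ S
    lemma = solve-∀

  ≡+-flip-even : ∀ {u v s} → Even M → Odd ∣ s ∣ → v ≡ u + s ⟨mod M ⟩ → Even u → Odd v
  ≡+-flip-even M-even s-odd v≡u+s u-even v-even =
    ≡+-odd⇒parities-differ M-even s-odd v≡u+s (inj₁ (u-even , v-even))

  ≡+-flip-odd : ∀ {u v s} → Even M → Odd ∣ s ∣ → v ≡ u + s ⟨mod M ⟩ → Odd u → Even v
  ≡+-flip-odd {v = v} M-even s-odd v≡u+s u-odd with 2 ∣? v
  ... | yes v-even = v-even
  ... | no v-odd = contradiction (inj₂ (u-odd , v-odd)) (≡+-odd⇒parities-differ M-even s-odd v≡u+s)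

  within-± : ∀ {b s u v} → s ∈± b → v ≡ u + s ⟨mod M ⟩ → Within M b u v
  within-± {s = s} s∈±b v≡u+s = s , ℕ.≤-reflexive (∈±-abs s∈±b) , v≡u+s

  within-refl : ∀ u → Within M 0 u u
  within-refl u = 0ℤ , z≤n , ≡+-refl u

  within-trans : ∀ {B C u w v} → Within M B u w → Within M C w v → Within M (B + C) u v
  within-trans (s , ∣s∣≤B , w≡u+s) (t , ∣t∣≤C , v≡w+t) =
    s ℤ.+ t , ℕ.≤-trans (ℤ.∣i+j∣≤∣i∣+∣j∣ s t) (ℕ.+-mono-≤ ∣s∣≤B ∣t∣≤C) ,
    ≡+-trans w≡u+s v≡w+t

  within-mono : ∀ {B C u v} → B ≤ C → Within M B u v → Within M C u v
  within-mono B≤C (z , ∣z∣≤B , v≡u+z) = z , ℕ.≤-trans ∣z∣≤B B≤C , v≡u+z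

  far-from-origin : ∀ {B d} → B < d → d + B < M → ¬ Within M B 0 d
  far-from-origin {B} {d} B<d d+B<M (z , ∣z∣≤B , mod M∣d-z) =
    ℕ.<-irrefl (sym d≡∣z∣) (ℕ.≤-<-trans ∣z∣≤B B<d)
    where
    ∣z∣≡∣0+z∣ : ∣ z ∣ ≡ ∣ 0ℤ ℤ.+ z ∣
    ∣z∣≡∣0+z∣ = cong ∣_∣ (sym (ℤ.+-identityˡ z))
    ∣d-z∣<M : ∣ + d - (0ℤ ℤ.+ z) ∣ < M
    ∣d-z∣<M = ℕ.≤-<-trans (ℤ.∣i-j∣≤∣i∣+∣j∣ (+ d) (0ℤ ℤ.+ z))
                (ℕ.≤-<-trans (ℕ.+-monoʳ-≤ d (subst (_≤ B) ∣z∣≡∣0+z∣ ∣z∣≤B)) d+B<M)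
    d≡∣z∣ : d ≡ ∣ z ∣
    d≡∣z∣ = cong ∣_∣ (trans (ℤ.i-j≡0⇒i≡j (+ d) (0ℤ ℤ.+ z) (multiple-<⇒≡0 M∣d-z ∣d-z∣<M))
                            (ℤ.+-identityˡ z))

-- Walks in NA(M; −a, a, c, −c)

walk-++ : ∀ {M α β γ δ m n u w v} →
          NAWalk M α β γ δ m u w → NAWalk M α β γ δ n w v → NAWalk M α β γ δ (m + n) u v
walk-++ (here _) q = q
walk-++ (step u<M arc p) q = step u<M arc (walk-++ p q)

module SymmetricNA (M a c : ℕ) .{{_ : NonZero M}} (M-even : Even M) (a-odd : Odd a) (c-odd : Odd c) where

  Arc : ℕ → ℕ → Set
  Arc = NAArc M (- + a) (+ a) (+ c) (- + c)

  Walk : ℕ → ℕ → ℕ → Set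
  Walk = NAWalk M (- + a) (+ a) (+ c) (- + c)

  step-from-even : ∀ {b s u v} → Odd b → s ∈± b → v ≡ u + s ⟨mod M ⟩ →
                   Even u → Within M b u v × Odd v
  step-from-even b-odd s∈±b v≡u+s u-even =
    within-± s∈±b v≡u+s , ≡+-flip-even M-even (∈±-odd b-odd s∈±b) v≡u+s u-even

  step-from-odd : ∀ {b s u v} → Odd b → s ∈± b → v ≡ u + s ⟨mod M ⟩ →
                  Odd u → Within M b u v × Even v
  step-from-odd b-odd s∈±b v≡u+s u-odd =
    within-± s∈±b v≡u+s , ≡+-flip-odd M-even (∈±-odd b-odd s∈±b) v≡u+s u-odd

  arc-from-even : ∀ {u v} → Even u → Arc u v → Within M a u v × Odd v
  arc-from-even {u} {v} u-even (arcα _ v≡u-a) = step-from-even a-odd minus ([mod]⇒⟨mod⟩ u v v≡u-a) u-even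
  arc-from-even {u} {v} u-even (arcβ _ v≡u+a) = step-from-even a-odd plus ([mod]⇒⟨mod⟩ u v v≡u+a) u-even
  arc-from-even u-even (arcγ u-odd _) = contradiction u-even u-odd
  arc-from-even u-even (arcδ u-odd _) = contradiction u-even u-odd

  arc-from-odd : ∀ {u v} → Odd u → Arc u v → Within M c u v × Even v
  arc-from-odd u-odd (arcα u-even _) = contradiction u-even u-odd
  arc-from-odd u-odd (arcβ u-even _) = contradiction u-even u-odd
  arc-from-odd {u} {v} u-odd (arcγ _ v≡u+c) = step-from-odd c-odd plus ([mod]⇒⟨mod⟩ u v v≡u+c) u-odd
  arc-from-odd {u} {v} u-odd (arcδ _ v≡u-c) = step-from-odd c-odd minus ([mod]⇒⟨mod⟩ u v v≡u-c) u-odd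

  walk-from-even : ∀ {n u v} → Even u → Walk n u v →
    (Even v × ∃ λ m → n ≡ m * 2 × Within M (m * (a + c)) u v) ⊎
    (Odd v × ∃ λ m → n ≡ suc (m * 2) × Within M (m * (a + c) + a) u v)
  walk-from-even {u = u} u-even (here _) = inj₁ (u-even , 0 , refl , within-refl u)
  walk-from-even u-even (step _ arc (here _)) =
    let (near , v-odd) = arc-from-even u-even arc in inj₂ (v-odd , 0 , refl , near)
  walk-from-even u-even (step _ arc (step _ arc′ rest)) with arc-from-even u-even arc
  ... | near₁ , w-odd with arc-from-odd w-odd arc′
  ...   | near₂ , w′-even with walk-from-even w′-even rest
  ...     | inj₁ (v-even , m , refl , near) =
              inj₁ (v-even , suc m , refl , within-trans (within-trans near₁ near₂) near)
  ...     | inj₂ (v-odd , m , refl , near) =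
              inj₂ (v-odd , suc m , refl ,
                    within-mono (ℕ.≤-reflexive (sym (ℕ.+-assoc (a + c) (m * (a + c)) a)))
                                (within-trans (within-trans near₁ near₂) near))

  walk-to-odd-length : ∀ {m₀ d n} → Odd d → m₀ * (a + c) + a < d → d + (m₀ * (a + c) + a) < M →
                       Walk n 0 d → suc (suc m₀ * 2) ≤ n
  walk-to-odd-length {m₀} d-odd B<d d+B<M walk with walk-from-even (2 ∣0) walk
  ... | inj₁ (d-even , _) = contradiction d-even d-odd
  ... | inj₂ (_ , m , refl , near) with m ℕ.≤? m₀
  ...   | yes m≤m₀ = contradiction (within-mono (ℕ.+-monoˡ-≤ a (ℕ.*-monoˡ-≤ (a + c) m≤m₀)) near)
                                   (far-from-origin B<d d+B<M)
  ...   | no m≰m₀ = s≤s (ℕ.*-monoˡ-≤ 2 (ℕ.≰⇒> m≰m₀))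

  walk-to-even-length : ∀ {m₀ d n} → Even d → m₀ * (a + c) < d → d + m₀ * (a + c) < M →
                        Walk n 0 d → suc m₀ * 2 ≤ n
  walk-to-even-length {m₀} d-even B<d d+B<M walk with walk-from-even (2 ∣0) walk
  ... | inj₂ (d-odd , _) = contradiction d-even d-odd
  ... | inj₁ (_ , m , refl , near) with m ℕ.≤? m₀
  ...   | yes m≤m₀ = contradiction (within-mono (ℕ.*-monoˡ-≤ (a + c) m≤m₀) near)
                                   (far-from-origin B<d d+B<M)
  ...   | no m≰m₀ = ℕ.*-monoˡ-≤ 2 (ℕ.≰⇒> m≰m₀)

  WalkWithin : ℕ → ℕ → ℕ → Set
  WalkWithin B u v = ∃ λ n → n ≤ B × Walk n u v

  walk-within-mono : ∀ {B C u v} → B ≤ C → WalkWithin B u v → WalkWithin C u v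
  walk-within-mono B≤C (n , n≤B , walk) = n , ℕ.≤-trans n≤B B≤C , walk

  Reaches : ℕ → ℕ → ℤ → Set
  Reaches n u s = ∀ {v} → v < M → v ≡ u + s ⟨mod M ⟩ → WalkWithin n u v

  reaches-zero : ∀ {u} → u < M → Reaches 0 u 0ℤ
  reaches-zero u<M v<M v≡u+0 with residue-unique u<M v<M v≡u+0
  ... | refl = 0 , z≤n , here u<M

  reaches-mono : ∀ {m n u s} → m ≤ n → Reaches m u s → Reaches n u s
  reaches-mono m≤n reach v<M v≡u+s = walk-within-mono m≤n (reach v<M v≡u+s)

  reaches-shift : ∀ {n u s t} → + M ∣ℤ (t - s) → Reaches n u s → Reaches n u t
  reaches-shift M∣t-s reach v<M v≡u+t = reach v<M (≡+-shift M∣t-s v≡u+t)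

  reaches-+ : ∀ {m n u s t} → Reaches m u s → (∀ {w} → w < M → w ≡ u + s ⟨mod M ⟩ → Reaches n w t) →
              Reaches (m + n) u (s ℤ.+ t)
  reaches-+ {u = u} {s} reach₁ reach₂ v<M v≡u+s+t =
    let (w , w<M , w≡u+s) = residue u s
        (m₁ , m₁≤m , walk₁) = reach₁ w<M w≡u+s
        (m₂ , m₂≤n , walk₂) = reach₂ w<M w≡u+s v<M (≡+-cancel w≡u+s v≡u+s+t)
    in m₁ + m₂ , ℕ.+-mono-≤ m₁≤m m₂≤n , walk-++ walk₁ walk₂

  reaches-arc-from-even : ∀ {u s} → u < M → Even u → s ∈± a → Reaches 1 u s
  reaches-arc-from-even u<M u-even plus v<M v≡u+a =
    1 , ℕ.≤-refl , step u<M (arcβ u-even (⟨mod⟩⇒[mod] v≡u+a)) (here v<M)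
  reaches-arc-from-even u<M u-even minus v<M v≡u-a =
    1 , ℕ.≤-refl , step u<M (arcα u-even (⟨mod⟩⇒[mod] v≡u-a)) (here v<M)

  reaches-arc-from-odd : ∀ {u t} → u < M → Odd u → t ∈± c → Reaches 1 u t
  reaches-arc-from-odd u<M u-odd plus v<M v≡u+c =
    1 , ℕ.≤-refl , step u<M (arcγ u-odd (⟨mod⟩⇒[mod] v≡u+c)) (here v<M)
  reaches-arc-from-odd u<M u-odd minus v<M v≡u-c =
    1 , ℕ.≤-refl , step u<M (arcδ u-odd (⟨mod⟩⇒[mod] v≡u-c)) (here v<M)

  reaches-pair : ∀ {u s t} → u < M → s ∈± a → t ∈± c → Reaches 2 u (s ℤ.+ t)
  reaches-pair {u} {s} {t} u<M s∈±a t∈±c with 2 ∣? u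
  ... | yes u-even = reaches-+ (reaches-arc-from-even u<M u-even s∈±a) λ w<M w≡u+s →
          reaches-arc-from-odd w<M (proj₂ (step-from-even a-odd s∈±a w≡u+s u-even)) t∈±c
  ... | no u-odd = subst (Reaches 2 u) (ℤ.+-comm t s)
        (reaches-+ (reaches-arc-from-odd u<M u-odd t∈±c) λ w<M w≡u+t →
          reaches-arc-from-even w<M (proj₂ (step-from-odd c-odd t∈±c w≡u+t u-odd)) s∈±a)

  reaches-ℕ-multiple : ∀ {s t} → s ∈± a → t ∈± c → ∀ x {u} → u < M →
                       Reaches (x * 2) u (+ x ℤ.* (s ℤ.+ t))
  reaches-ℕ-multiple s∈±a t∈±c zero u<M = reaches-zero u<M
  reaches-ℕ-multiple {s} {t} s∈±a t∈±c (suc x) {u} u<M = subst (Reaches _ u) (lemma (+ x) (s ℤ.+ t))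
    (reaches-+ (reaches-pair u<M s∈±a t∈±c) λ w<M _ → reaches-ℕ-multiple s∈±a t∈±c x w<M)
    where
    lemma : ∀ X P → P ℤ.+ X ℤ.* P ≡ (+ 1 ℤ.+ X) ℤ.* P
    lemma = solve-∀

  reaches-multiple : ∀ {s t} → s ∈± a → t ∈± c → ∀ x {u} → u < M →
                     Reaches (∣ x ∣ * 2) u (x ℤ.* (s ℤ.+ t))
  reaches-multiple s∈±a t∈±c (+ x) u<M = reaches-ℕ-multiple s∈±a t∈±c x u<M
  reaches-multiple {s} {t} s∈±a t∈±c -[1+ x ] {u} u<M = subst (Reaches _ u) (lemma (+ x) s t)
    (reaches-ℕ-multiple (∈±-neg s∈±a) (∈±-neg t∈±c) (suc x) u<M)
    where
    lemma : ∀ X S T → (+ 1 ℤ.+ X) ℤ.* (- S ℤ.+ - T) ≡ (- (+ 1 ℤ.+ X)) ℤ.* (S ℤ.+ T)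
    lemma = solve-∀

  reaches-lattice : ∀ x y {u} → u < M →
                    Reaches ((∣ x ∣ + ∣ y ∣) * 2) u (x ℤ.* (+ a ℤ.+ + c) ℤ.+ y ℤ.* (- + a ℤ.+ + c))
  reaches-lattice x y {u} u<M =
    subst (λ n → Reaches n u (x ℤ.* (+ a ℤ.+ + c) ℤ.+ y ℤ.* (- + a ℤ.+ + c)))
          (sym (ℕ.*-distribʳ-+ 2 ∣ x ∣ ∣ y ∣))
          (reaches-+ (reaches-multiple plus plus x u<M) λ w<M _ → reaches-multiple minus plus y w<M)

-- Representations e = x(K + 1) + yK and coverings of ℤ/N

R : ℕ → ℤ → ℤ → ℤ
R K x y = x ℤ.* (+ K ℤ.+ + 1) ℤ.+ y ℤ.* + K

Representable : ℕ → ℕ → ℕ → Set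
Representable K C e = ∃₂ λ x y → ∣ x ∣ + ∣ y ∣ ≤ C × + e ≡ R K x y

RepresentableUpTo : ℕ → ℕ → ℕ → Set
RepresentableUpTo K C L = ∀ e → e ≤ L → Representable K C e

representable-ℕ : ∀ {K C e} x y → x + y ≤ C → e ≡ x * (K + 1) + y * K → Representable K C e
representable-ℕ {K} x y cost refl = + x , + y , cost ,
  trans (cong₂ ℤ._+_ (ℤ.pos-* x (K + 1)) (ℤ.pos-* y K))
        (cong (λ P → + x ℤ.* P ℤ.+ + y ℤ.* + K) (ℤ.pos-+ K 1))

-- Writing e = r + q K with r < K, take (x , y) = (r , q - r) when r ≤ q; otherwise the cheaper of
-- (r , q - r) and (r - K , q + K + 1 - r).
representable-digits : ∀ K q r → r < K → q ≤ K → Representable K K (r + q * K)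
representable-digits K q r r<K q≤K with ℕ.≤-<-connex r q
... | inj₁ r≤q with ℕ.m≤n⇒∃[o]m+o≡n r≤q
...   | j , refl = representable-ℕ r j q≤K (lemma r j K)
  where
  lemma : ∀ r j K → r + (r + j) * K ≡ r * (K + 1) + j * K
  lemma = NatSolver.solve-∀
representable-digits K q r r<K q≤K | inj₂ q<r with ℕ.m≤n⇒∃[o]m+o≡n q<r | ℕ.m≤n⇒∃[o]m+o≡n r<K
... | j , refl | i , refl with ℕ.≤-<-connex j i
...   | inj₁ j≤i with ℕ.m≤n⇒∃[o]m+o≡n j≤i
...     | t , refl = + suc (q + j) , -[1+ j ] , ≤-by t (cost q j t) ,
                     trans (cong (λ X → + suc (q + j) ℤ.+ X) (ℤ.pos-* q _))
                           (lemma (+ q) (+ j) (+ suc (suc (q + j) + (j + t))))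
  where
  cost : ∀ q j t → suc (q + j) + suc j + t ≡ suc (suc (q + j) + (j + t))
  cost = NatSolver.solve-∀
  lemma : ∀ Q J K → (+ 1 ℤ.+ (Q ℤ.+ J)) ℤ.+ Q ℤ.* K ≡
                    (+ 1 ℤ.+ (Q ℤ.+ J)) ℤ.* (K ℤ.+ + 1) ℤ.+ (- (+ 1 ℤ.+ J)) ℤ.* K
  lemma = solve-∀
representable-digits K q r r<K q≤K | inj₂ q<r | j , refl | i , refl | inj₂ i<j with ℕ.m≤n⇒∃[o]m+o≡n i<j
... | t , refl = -[1+ i ] , + suc (suc (q + i)) , ≤-by t (cost q i t) ,
                 trans (cong (λ X → + suc (q + suc (i + t)) ℤ.+ X) (ℤ.pos-* q _))
                       (lemma (+ q) (+ suc (q + suc (i + t))) (+ i))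
  where
  cost : ∀ q i t → suc i + suc (suc (q + i)) + t ≡ suc (suc (q + suc (i + t)) + i)
  cost = NatSolver.solve-∀
  lemma : ∀ Q R I → R ℤ.+ Q ℤ.* (+ 1 ℤ.+ (R ℤ.+ I)) ≡
                    (- (+ 1 ℤ.+ I)) ℤ.* ((+ 1 ℤ.+ (R ℤ.+ I)) ℤ.+ + 1)
                      ℤ.+ (+ 1 ℤ.+ (+ 1 ℤ.+ (Q ℤ.+ I))) ℤ.* (+ 1 ℤ.+ (R ℤ.+ I))
  lemma = solve-∀

representable-mono : ∀ {K C D e} → C ≤ D → Representable K C e → Representable K D e
representable-mono C≤D (x , y , cost , e≡R) = x , y , ℕ.≤-trans cost C≤D , e≡R

representable-≤K²+K : ∀ K .{{_ : NonZero K}} → RepresentableUpTo K K (K * K + K)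
representable-≤K²+K K e e≤K²+K with ℕ.m≤n⇒m<n∨m≡n e≤K²+K
... | inj₂ refl = + K , 0ℤ , ℕ.≤-reflexive (ℕ.+-identityʳ K) ,
                  trans (cong (ℤ._+ + K) (ℤ.pos-* K K)) (lemma (+ K))
  where
  lemma : ∀ K → K ℤ.* K ℤ.+ K ≡ K ℤ.* (K ℤ.+ + 1) ℤ.+ 0ℤ ℤ.* K
  lemma = solve-∀
... | inj₁ e<K²+K = subst (Representable K K) (sym (DivMod.m≡m%n+[m/n]*n e K))
                      (representable-digits K (e DivMod./ K) (e DivMod.% K) (DivMod.m%n<n e K) q≤K)
  where
  q≤K : e DivMod./ K ≤ K
  q≤K = ℕ.≤-pred (ℕ.*-cancelʳ-< K _ (suc K) (ℕ.≤-<-trans (DivMod.m/n*n≤m e K)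
          (ℕ.<-≤-trans e<K²+K (ℕ.≤-reflexive (ℕ.+-comm (K * K) K)))))

representable-K²+K+1+t : ∀ K t → t ≤ K → Representable K (suc K) (suc (K * K + K) + t)
representable-K²+K+1+t K t t≤K with ℕ.m≤n⇒∃[o]m+o≡n t≤K
... | s , refl = representable-ℕ (suc t) s ℕ.≤-refl (lemma t s)
  where
  lemma : ∀ t s → suc ((t + s) * (t + s) + (t + s)) + t ≡ suc t * ((t + s) + 1) + s * (t + s)
  lemma = NatSolver.solve-∀

representable-≤[1+K]² : ∀ K .{{_ : NonZero K}} → RepresentableUpTo K (suc K) (suc K * suc K)
representable-≤[1+K]² K e e≤[1+K]² with e ℕ.≤? K * K + K
... | yes e≤K²+K = representable-mono (ℕ.n≤1+n K) (representable-≤K²+K K e e≤K²+K)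
... | no e≰K²+K with ℕ.m≤n⇒∃[o]m+o≡n (ℕ.≰⇒> e≰K²+K)
...   | t , refl = representable-K²+K+1+t K t
        (ℕ.+-cancelˡ-≤ (suc (K * K + K)) t K (ℕ.≤-trans e≤[1+K]² (ℕ.≤-reflexive (lemma K))))
  where
  lemma : ∀ K → suc K * suc K ≡ suc (K * K + K) + K
  lemma = NatSolver.solve-∀

module Covering (K N : ℕ) .{{_ : NonZero N}} where

  Covered : ℕ → ℤ → Set
  Covered C h = ∃₂ λ x y → ∣ x ∣ + ∣ y ∣ ≤ C × + N ∣ℤ (h - R K x y)

  divides-minus-residue : ∀ h → + N ∣ℤ (h - + (h %ℕ N))
  divides-minus-residue h = divides (h /ℕ N)
    (trans (cong (_- + (h %ℕ N)) (a≡a%ℕn+[a/ℕn]*n h N)) (lemma (+ (h %ℕ N)) (h /ℕ N) (+ N)))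
    where
    lemma : ∀ R Q N → (R ℤ.+ Q ℤ.* N) - R ≡ Q ℤ.* N
    lemma = solve-∀

  covered-or-gap : ∀ {C L} → RepresentableUpTo K C L → ∀ h →
                   Covered C h ⊎ ∃ λ r → L < r × r + L < N × + N ∣ℤ (h - + r)
  covered-or-gap {C} {L} rep h with h %ℕ N ℕ.≤? L
  ... | yes r≤L = let (x , y , cost , r≡R) = rep _ r≤L in
        inj₁ (x , y , cost , subst (λ j → + N ∣ℤ (h - j)) r≡R (divides-minus-residue h))
  ... | no r≰L with N ℕ.≤? h %ℕ N + L
  ...   | no N≰r+L = inj₂ (h %ℕ N , ℕ.≰⇒> r≰L , ℕ.≰⇒> N≰r+L , divides-minus-residue h)
  ...   | yes N≤r+L with ℕ.m≤n⇒∃[o]m+o≡n (ℕ.<⇒≤ (n%ℕd<d h N))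
  ...     | e , r+e≡N with rep e (ℕ.+-cancelˡ-≤ (h %ℕ N) e L (subst (_≤ h %ℕ N + L) (sym r+e≡N) N≤r+L))
  ...       | x , y , cost , e≡R = inj₁ (- x , - y ,
      subst₂ (λ i j → i + j ≤ C) (sym (ℤ.∣-i∣≡∣i∣ x)) (sym (ℤ.∣-i∣≡∣i∣ y)) cost ,
      subst (+ N ∣ℤ_) h-r+N≡h-R (Signed.∣m∣n⇒∣m+n (divides-minus-residue h) (Signed.∣-refl {+ N})))
    where
    open ≡-Reasoning
    lemma : ∀ H R X Y K → (H - R) ℤ.+ (R ℤ.+ (X ℤ.* (K ℤ.+ + 1) ℤ.+ Y ℤ.* K)) ≡
                          H - ((- X) ℤ.* (K ℤ.+ + 1) ℤ.+ (- Y) ℤ.* K)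
    lemma = solve-∀
    h-r+N≡h-R : (h - + (h %ℕ N)) ℤ.+ + N ≡ h - R K (- x) (- y)
    h-r+N≡h-R = begin
      (h - + (h %ℕ N)) ℤ.+ + N                       ≡⟨ cong (λ n → (h - + (h %ℕ N)) ℤ.+ + n) r+e≡N ⟨
      (h - + (h %ℕ N)) ℤ.+ (+ (h %ℕ N) ℤ.+ + e)      ≡⟨ cong (λ E → (h - + (h %ℕ N)) ℤ.+ (+ (h %ℕ N) ℤ.+ E)) e≡R ⟩
      (h - + (h %ℕ N)) ℤ.+ (+ (h %ℕ N) ℤ.+ R K x y)  ≡⟨ lemma h (+ (h %ℕ N)) x y (+ K) ⟩
      h - R K (- x) (- y)                            ∎

  all-covered : ∀ {C L} → N ≤ suc (L + L) → RepresentableUpTo K C L → ∀ h → Covered C h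
  all-covered {L = L} N≤2L+1 rep h with covered-or-gap rep h
  ... | inj₁ covered = covered
  ... | inj₂ (r , L<r , r+L<N , _) =
        contradiction (ℕ.<-≤-trans r+L<N N≤2L+1) (ℕ.≤⇒≯ (ℕ.+-monoˡ-≤ L L<r))

  gap-unique : ∀ {L r} → N ≡ suc (suc (L + L)) → L < r → r + L < N → r ≡ suc L
  gap-unique {L} {r} N≡2L+2 L<r r+L<N = ℕ.≤-antisym
    (ℕ.+-cancelʳ-≤ L r (suc L) (ℕ.≤-pred (ℕ.≤-trans r+L<N (ℕ.≤-reflexive N≡2L+2)))) L<r

  -- For N = 2L + 2 the only uncovered residue is L + 1, and h, h + s cannot both be ≡ L + 1.
  covered-or-shift-covered : ∀ {C L} → N ≡ suc (suc (L + L)) → RepresentableUpTo K C L →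
                             ∀ h s → ¬ + N ∣ℤ s → Covered C h ⊎ Covered C (h ℤ.+ s)
  covered-or-shift-covered N≡2L+2 rep h s N∤s with covered-or-gap rep h | covered-or-gap rep (h ℤ.+ s)
  ... | inj₁ covered | _ = inj₁ covered
  ... | inj₂ _ | inj₁ covered = inj₂ covered
  ... | inj₂ (r , L<r , r+L<N , N∣h-r) | inj₂ (r′ , L<r′ , r′+L<N , N∣h+s-r′)
    with gap-unique N≡2L+2 L<r r+L<N | gap-unique N≡2L+2 L<r′ r′+L<N
  ...   | refl | refl =
          contradiction (subst (+ N ∣ℤ_) (lemma h s (+ r)) (Signed.∣m∣n⇒∣m-n N∣h+s-r′ N∣h-r)) N∤s
    where
    lemma : ∀ H S R → ((H ℤ.+ S) - R) - (H - R) ≡ S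
    lemma = solve-∀

-- NA(2N; −1, 1, 2k+1, −2k−1)

module NA±1±[2k+1] (k N : ℕ) .{{_ : NonZero N}} where

  M G : ℕ
  M = N * 2
  G = 2 * k + 1

  open SymmetricNA M 1 G {{ℕ.m*n≢0 N 2}} (divides N refl) (odd-2k+1 0) (odd-2k+1 k) public
  open Covering k N public

  lattice≡R*2 : ∀ x y → x ℤ.* (+ 1 ℤ.+ + G) ℤ.+ y ℤ.* (- + 1 ℤ.+ + G) ≡ R k x y ℤ.* + 2
  lattice≡R*2 x y = trans (cong (λ g → x ℤ.* (+ 1 ℤ.+ (g ℤ.+ + 1)) ℤ.+ y ℤ.* (- + 1 ℤ.+ (g ℤ.+ + 1))) (ℤ.pos-* 2 k))
                          (lemma x y (+ k))
    where
    lemma : ∀ X Y K → X ℤ.* (+ 1 ℤ.+ (+ 2 ℤ.* K ℤ.+ + 1)) ℤ.+ Y ℤ.* (- + 1 ℤ.+ (+ 2 ℤ.* K ℤ.+ + 1)) ≡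
                      (X ℤ.* (K ℤ.+ + 1) ℤ.+ Y ℤ.* K) ℤ.* + 2
    lemma = solve-∀

  reaches-covered : ∀ {C u} h → u < M → Covered C h → Reaches (C * 2) u (h ℤ.* + 2)
  reaches-covered h u<M (x , y , cost , N∣h-R) =
    reaches-mono (ℕ.*-monoˡ-≤ 2 cost) (reaches-shift M∣2h-lattice (reaches-lattice x y u<M))
    where
    M∣2h-lattice : + M ∣ℤ (h ℤ.* + 2 - (x ℤ.* (+ 1 ℤ.+ + G) ℤ.+ y ℤ.* (- + 1 ℤ.+ + G)))
    M∣2h-lattice = subst₂ _∣ℤ_ (sym (ℤ.pos-* N 2))
      (trans (lemma h (R k x y)) (cong (λ l → h ℤ.* + 2 - l) (sym (lattice≡R*2 x y))))
      (Signed.*-monoˡ-∣ (+ 2) N∣h-R)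
      where
      lemma : ∀ H P → (H - P) ℤ.* + 2 ≡ H ℤ.* + 2 - P ℤ.* + 2
      lemma = solve-∀

  walk-same-parity : ∀ {C u v} → u < M → v < M → (∀ h → Covered C h) →
                     (Even u × Even v) ⊎ (Odd u × Odd v) → WalkWithin (C * 2) u v
  walk-same-parity u<M v<M covered parities with same-parity⇒2∣difference parities
  ... | divides h v-u≡2h = reaches-covered h u<M (covered h) v<M (≡+-exact v-u≡2h)

  walk-opposite-parity : ∀ {C S u v} → u < M → v < M → Odd S → (∀ {s} → s ∈± S → Reaches 1 u s) →
                         (∀ h → Covered C h ⊎ Covered C (h ℤ.+ + S)) →
                         (Even u × Odd v) ⊎ (Odd u × Even v) → WalkWithin (suc (C * 2)) u v
  walk-opposite-parity {S = S} u<M v<M S-odd first-step covered parities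
    with halve-difference (opposite-parity⇒2∣difference S-odd parities)
  ... | h , v-u≡S+2h with covered h
  ...   | inj₁ covered-h =
          reaches-+ (first-step plus) (λ w<M _ → reaches-covered h w<M covered-h) v<M (≡+-exact v-u≡S+2h)
  ...   | inj₂ covered-h+S =
          reaches-+ (first-step minus) (λ w<M _ → reaches-covered (h ℤ.+ + S) w<M covered-h+S) v<M
            (≡+-exact (trans v-u≡S+2h (lemma (+ S) h)))
    where
    lemma : ∀ S H → S ℤ.+ H ℤ.* + 2 ≡ - S ℤ.+ (H ℤ.+ S) ℤ.* + 2
    lemma = solve-∀

  1≤G : 1 ≤ G
  1≤G = ℕ.m≤n+m 1 (2 * k)

  diameter-≤ : ∀ {Cₑ Cₒ D} → Cₑ * 2 ≤ D → suc (Cₒ * 2) ≤ D → G < N → (∀ h → Covered Cₑ h) →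
               (∀ h s → ¬ + N ∣ℤ s → Covered Cₒ h ⊎ Covered Cₒ (h ℤ.+ s)) →
               ∀ u v → u < M → v < M → WalkWithin D u v
  diameter-≤ even≤D odd≤D G<N covered covered-or-shifted u v u<M v<M with 2 ∣? u | 2 ∣? v
  ... | yes u-even | yes v-even =
        walk-within-mono even≤D (walk-same-parity u<M v<M covered (inj₁ (u-even , v-even)))
  ... | no u-odd   | no v-odd   =
        walk-within-mono even≤D (walk-same-parity u<M v<M covered (inj₂ (u-odd , v-odd)))
  ... | yes u-even | no v-odd   =
        walk-within-mono odd≤D (walk-opposite-parity u<M v<M (odd-2k+1 0) (reaches-arc-from-even u<M u-even)
          (λ h → covered-or-shifted h (+ 1) (small-not-divisible (s≤s z≤n) (ℕ.≤-<-trans 1≤G G<N)))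
          (inj₁ (u-even , v-odd)))
  ... | no u-odd   | yes v-even =
        walk-within-mono odd≤D (walk-opposite-parity u<M v<M (odd-2k+1 k) (reaches-arc-from-odd u<M u-odd)
          (λ h → covered-or-shifted h (+ G) (small-not-divisible 1≤G G<N))
          (inj₂ (u-odd , v-even)))

  diameter-≥-odd : ∀ {m₀ d D} → D ≤ suc (suc m₀ * 2) → Odd d →
                   m₀ * (1 + G) + 1 < d → d + (m₀ * (1 + G) + 1) < M →
                   ∃₂ λ u v → u < M × v < M × (∀ n → n < D → ¬ Walk n u v)
  diameter-≥-odd {m₀} {d} D≤ d-odd B<d d+B<M = 0 , d , ℕ.≤-<-trans z≤n d<M , d<M ,
    λ n n<D walk → ℕ.<⇒≱ (ℕ.<-≤-trans n<D D≤) (walk-to-odd-length {m₀} d-odd B<d d+B<M walk)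
    where
    d<M : d < M
    d<M = ℕ.m+n≤o⇒m≤o (suc d) d+B<M

  diameter-≥-even : ∀ {m₀ d D} → D ≤ suc m₀ * 2 → Even d →
                    m₀ * (1 + G) < d → d + m₀ * (1 + G) < M →
                    ∃₂ λ u v → u < M × v < M × (∀ n → n < D → ¬ Walk n u v)
  diameter-≥-even {m₀} {d} D≤ d-even B<d d+B<M = 0 , d , ℕ.≤-<-trans z≤n d<M , d<M ,
    λ n n<D walk → ℕ.<⇒≱ (ℕ.<-≤-trans n<D D≤) (walk-to-even-length {m₀} d-even B<d d+B<M walk)
    where
    d<M : d < M
    d<M = ℕ.m+n≤o⇒m≤o (suc d) d+B<M

diameter-a : ∀ k N .{{_ : NonZero N}} → 1 ≤ k → 4 * k * k + 4 ≤ N * 2 → N * 2 ≤ 4 * k * k + 4 * k + 2 →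
             NADiameter (N * 2) (- (+ 1)) (+ 1) (+ (2 * k + 1)) (- (+ (2 * k + 1))) (2 * k + 1)
diameter-a k@(suc k′) N (s≤s z≤n) 4k²+4≤M M≤4k²+4k+2 =
  diameter-≤ even≤D odd≤D G<N covered (λ h _ _ → inj₁ (covered h)) ,
  diameter-≥-odd {m₀ = k′} D≤ (odd-2k+1 (k * k)) B<d d+B<M
  where
  open NA±1±[2k+1] k N
  2k²+2≤N : 2 * k * k + 2 ≤ N
  2k²+2≤N = ℕ.*-cancelʳ-≤ _ N 2 (ℕ.≤-trans (ℕ.≤-reflexive (ring k)) 4k²+4≤M)
    where ring : ∀ k → (2 * k * k + 2) * 2 ≡ 4 * k * k + 4
          ring = NatSolver.solve-∀
  G<N : G < N
  G<N = ℕ.≤-trans (≤-by (2 * k′ * k′ + 2 * k′) (ring k′)) 2k²+2≤N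
    where ring : ∀ k′ → suc (2 * suc k′ + 1) + (2 * k′ * k′ + 2 * k′) ≡ 2 * suc k′ * suc k′ + 2
          ring = NatSolver.solve-∀
  covered : ∀ h → Covered k h
  covered = all-covered (ℕ.*-cancelʳ-≤ N _ 2 (ℕ.≤-trans M≤4k²+4k+2 (ℕ.≤-reflexive (ring k)))) (representable-≤K²+K k)
    where ring : ∀ k → 4 * k * k + 4 * k + 2 ≡ suc ((k * k + k) + (k * k + k)) * 2
          ring = NatSolver.solve-∀
  even≤D : k * 2 ≤ 2 * k + 1
  even≤D = ≤-by 1 (ring k)
    where ring : ∀ k → k * 2 + 1 ≡ 2 * k + 1
          ring = NatSolver.solve-∀
  odd≤D : suc (k * 2) ≤ 2 * k + 1
  odd≤D = ≤-by 0 (ring k)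
    where ring : ∀ k → suc (k * 2) + 0 ≡ 2 * k + 1
          ring = NatSolver.solve-∀
  D≤ : 2 * k + 1 ≤ suc (suc k′ * 2)
  D≤ = ℕ.≤-reflexive (ring k′)
    where ring : ∀ k′ → 2 * suc k′ + 1 ≡ suc (suc k′ * 2)
          ring = NatSolver.solve-∀
  B<d : k′ * (1 + G) + 1 < 2 * (k * k) + 1
  B<d = ≤-by 1 (ring k′)
    where ring : ∀ k′ → suc (k′ * (1 + (2 * suc k′ + 1)) + 1) + 1 ≡ 2 * (suc k′ * suc k′) + 1
          ring = NatSolver.solve-∀
  d+B<M : 2 * (k * k) + 1 + (k′ * (1 + G) + 1) < M
  d+B<M = ℕ.≤-trans (≤-by 3 (ring k′)) 4k²+4≤M
    where ring : ∀ k′ → suc (2 * (suc k′ * suc k′) + 1 + (k′ * (1 + (2 * suc k′ + 1)) + 1)) + 3 ≡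
                        4 * suc k′ * suc k′ + 4
          ring = NatSolver.solve-∀

diameter-b : ∀ k N .{{_ : NonZero N}} → 1 ≤ k → N * 2 ≡ 4 * k * k + 4 * k + 4 →
             NADiameter (N * 2) (- (+ 1)) (+ 1) (+ (2 * k + 1)) (- (+ (2 * k + 1))) (2 * k + 2)
diameter-b k@(suc _) N (s≤s z≤n) M≡4k²+4k+4 =
  diameter-≤ even≤D odd≤D G<N
    (all-covered N≤2[k+1]²+1 (representable-≤[1+K]² k))
    (covered-or-shift-covered N≡2L+2 (representable-≤K²+K k)) ,
  diameter-≥-even {m₀ = k} D≤ (divides (k * k + k + 1) (ℕ.*-comm 2 _)) B<d d+B<M
  where
  open NA±1±[2k+1] k N
  L : ℕ
  L = k * k + k
  N≡2L+2 : N ≡ suc (suc (L + L))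
  N≡2L+2 = ℕ.*-cancelʳ-≡ N _ 2 (trans M≡4k²+4k+4 (ring k))
    where ring : ∀ k → 4 * k * k + 4 * k + 4 ≡ suc (suc ((k * k + k) + (k * k + k))) * 2
          ring = NatSolver.solve-∀
  N≤2[k+1]²+1 : N ≤ suc (suc k * suc k + suc k * suc k)
  N≤2[k+1]²+1 = ℕ.≤-trans (ℕ.≤-reflexive N≡2L+2) (≤-by (2 * k + 1) (ring k))
    where ring : ∀ k → suc (suc ((k * k + k) + (k * k + k))) + (2 * k + 1) ≡ suc (suc k * suc k + suc k * suc k)
          ring = NatSolver.solve-∀
  G<N : G < N
  G<N = ℕ.≤-trans (≤-by (2 * k * k) (ring k)) (ℕ.≤-reflexive (sym N≡2L+2))
    where ring : ∀ k → suc (2 * k + 1) + 2 * k * k ≡ suc (suc ((k * k + k) + (k * k + k)))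
          ring = NatSolver.solve-∀
  even≤D : suc k * 2 ≤ 2 * k + 2
  even≤D = ≤-by 0 (ring k)
    where ring : ∀ k → suc k * 2 + 0 ≡ 2 * k + 2
          ring = NatSolver.solve-∀
  odd≤D : suc (k * 2) ≤ 2 * k + 2
  odd≤D = ≤-by 1 (ring k)
    where ring : ∀ k → suc (k * 2) + 1 ≡ 2 * k + 2
          ring = NatSolver.solve-∀
  D≤ : 2 * k + 2 ≤ suc k * 2
  D≤ = ℕ.≤-reflexive (ring k)
    where ring : ∀ k → 2 * k + 2 ≡ suc k * 2
          ring = NatSolver.solve-∀
  B<d : k * (1 + G) < 2 * (k * k + k + 1)
  B<d = ≤-by 1 (ring k)
    where ring : ∀ k → suc (k * (1 + (2 * k + 1))) + 1 ≡ 2 * (k * k + k + 1)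
          ring = NatSolver.solve-∀
  d+B<M : 2 * (k * k + k + 1) + k * (1 + G) < M
  d+B<M = ≤-by 1 (trans (ring k) (sym M≡4k²+4k+4))
    where ring : ∀ k → suc (2 * (k * k + k + 1) + k * (1 + (2 * k + 1))) + 1 ≡ 4 * k * k + 4 * k + 4
          ring = NatSolver.solve-∀

diameter-c : ∀ k N .{{_ : NonZero N}} → 1 ≤ k →
             4 * k * k + 4 * k + 8 ≤ N * 2 → N * 2 ≤ 4 * (k + 1) * (k + 1) + 2 →
             NADiameter (N * 2) (- (+ 1)) (+ 1) (+ (2 * k + 1)) (- (+ (2 * k + 1))) (2 * k + 3)
diameter-c k@(suc _) N (s≤s z≤n) 4k²+4k+8≤M M≤4[k+1]²+2 =
  diameter-≤ even≤D odd≤D G<N covered (λ h _ _ → inj₁ (covered h)) ,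
  diameter-≥-odd {m₀ = k} D≤ (odd-2k+1 (k * k + k + 1)) B<d d+B<M
  where
  open NA±1±[2k+1] k N
  G<N : G < N
  G<N = ℕ.*-cancelʳ-≤ _ N 2 (ℕ.≤-trans (≤-by (4 * k * k + 4) (ring k)) 4k²+4k+8≤M)
    where ring : ∀ k → suc (2 * k + 1) * 2 + (4 * k * k + 4) ≡ 4 * k * k + 4 * k + 8
          ring = NatSolver.solve-∀
  covered : ∀ h → Covered (suc k) h
  covered = all-covered (ℕ.*-cancelʳ-≤ N _ 2 (ℕ.≤-trans M≤4[k+1]²+2 (ℕ.≤-reflexive (ring k))))
                        (representable-≤[1+K]² k)
    where ring : ∀ k → 4 * (k + 1) * (k + 1) + 2 ≡ suc (suc k * suc k + suc k * suc k) * 2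
          ring = NatSolver.solve-∀
  even≤D : suc k * 2 ≤ 2 * k + 3
  even≤D = ≤-by 1 (ring k)
    where ring : ∀ k → suc k * 2 + 1 ≡ 2 * k + 3
          ring = NatSolver.solve-∀
  odd≤D : suc (suc k * 2) ≤ 2 * k + 3
  odd≤D = ≤-by 0 (ring k)
    where ring : ∀ k → suc (suc k * 2) + 0 ≡ 2 * k + 3
          ring = NatSolver.solve-∀
  D≤ : 2 * k + 3 ≤ suc (suc k * 2)
  D≤ = ℕ.≤-reflexive (ring k)
    where ring : ∀ k → 2 * k + 3 ≡ suc (suc k * 2)
          ring = NatSolver.solve-∀
  B<d : k * (1 + G) + 1 < 2 * (k * k + k + 1) + 1
  B<d = ≤-by 1 (ring k)
    where ring : ∀ k → suc (k * (1 + (2 * k + 1)) + 1) + 1 ≡ 2 * (k * k + k + 1) + 1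
          ring = NatSolver.solve-∀
  d+B<M : 2 * (k * k + k + 1) + 1 + (k * (1 + G) + 1) < M
  d+B<M = ℕ.≤-trans (≤-by 3 (ring k)) 4k²+4k+8≤M
    where ring : ∀ k → suc (2 * (k * k + k + 1) + 1 + (k * (1 + (2 * k + 1)) + 1)) + 3 ≡ 4 * k * k + 4 * k + 8
          ring = NatSolver.solve-∀

theorem4p2 : (k M : ℕ) → 1 ≤ k → 2 ∣ M →
    ((4 * k * k + 4 ≤ M → M ≤ 4 * k * k + 4 * k + 2 →
        NADiameter M (- (+ 1)) (+ 1) (+ (2 * k + 1)) (- (+ (2 * k + 1))) (2 * k + 1))
    × (M ≡ 4 * k * k + 4 * k + 4 →
        NADiameter M (- (+ 1)) (+ 1) (+ (2 * k + 1)) (- (+ (2 * k + 1))) (2 * k + 2))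
    × (4 * k * k + 4 * k + 8 ≤ M → M ≤ 4 * (k + 1) * (k + 1) + 2 →
        NADiameter M (- (+ 1)) (+ 1) (+ (2 * k + 1)) (- (+ (2 * k + 1))) (2 * k + 3)))
theorem4p2 k .(zero * 2) 1≤k (divides zero refl) =
  (λ 4k²+4≤0 _ → contradiction (ℕ.m+n≤o⇒n≤o (4 * k * k) 4k²+4≤0) λ ()) ,
  (λ 0≡4k²+4k+4 → contradiction (ℕ.m+n≡0⇒n≡0 (4 * k * k + 4 * k) (sym 0≡4k²+4k+4)) λ ()) ,
  (λ 4k²+4k+8≤0 _ → contradiction (ℕ.m+n≤o⇒n≤o (4 * k * k + 4 * k) 4k²+4k+8≤0) λ ())
theorem4p2 k .(suc N * 2) 1≤k (divides (suc N) refl) =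
  diameter-a k (suc N) 1≤k , diameter-b k (suc N) 1≤k , diameter-c k (suc N) 1≤k
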